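{- Let $n\ge 3$ and let $a$ be an integer with $0\le a\le n-1$. The unidirectional cycle $\overrightarrow{C_n}$ is $D$-antimagic for each of the following sets $D$: (1) $D=\{a,(a+1)\bmod n\}$; (2) $D=\{a,(a+2)\bmod n\}$, provided $n\ne 4$; (3) $D=\{a,(a+3)\bmod n\}$, provided $n\ge 4$ and $n\ne 6$; (4) $D=\{0,1,\dots,n-1\}\setminus\{a,(a+1)\bmod n\}$; (5) $D=\{0,1,\dots,n-1\}\setminus\{a,(a+2)\bmod n\}$, provided $n\ne 4$; (6) $D=\{0,1,\dots,n-1\}\setminus\{a,(a+3)\bmod n\}$, provided $n\ge 4$ and $n\ne 6$.
   Context: The unidirectional cycle $\overrightarrow{C_n}$ has vertices $v_1,\dots,v_n$ and arcs $(v_i,v_{i+1})$ for $1\le i\le n-1$ and $(v_n,v_1)$, so $d(v_i,v_j)=(j-i)\bmod n$, where $d(u,y)$ is the length of a shortest directed path. $N_D(v)=\{y:d(v,y)\in D\}$; a bijection $f:V\to\{1,\dots,n\}$ is $D$-antimagic if $\omega_D(v)=\sum_{y\in N_D(v)}f(y)$ are pairwise distinct; the graph is $D$-antimagic if such a bijection exists. -}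

module Defs where

open import Data.Nat using (ℕ; zero; suc; _+_; _*_; _∸_; _≡ᵇ_; _%_; NonZero)
open import Data.Bool using (Bool; true; false; _∨_; not; if_then_else_)
open import Data.Fin using (Fin; toℕ)
open import Data.List using (List; map; allFin)
open import Data.Nat.ListAction using (sum)
open import Function.Definitions using (Injective)
open import Relation.Binary.PropositionalEquality using (_≡_)
open import Data.Product using (∃; _×_)

-- Vertices of the unidirectional cycle C⃗ₙ are Fin n; vertex i ∈ Fin n stands
-- for v_{i+1}.  Arcs are (i, i+1 mod n).  Shortest directed distance:
-- d(v_i, v_j) = (j - i) mod n.
dist : (n : ℕ) .{{_ : NonZero n}} → Fin n → Fin n → ℕ
dist n i j = (toℕ j + n ∸ toℕ i) % n

DistSet : Set
DistSet = ℕ → Bool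

-- ω_D(v) = Σ_{y : d(v,y) ∈ D} f(y), where the labels are f(y) = toℕ (g y) + 1
-- for a bijection g : Fin n → Fin n (i.e. f : V → {1,…,n} bijective).
weight : (n : ℕ) .{{_ : NonZero n}} → DistSet → (Fin n → Fin n) → Fin n → ℕ
weight n D g v =
  sum (map (λ y → if D (dist n v y) then suc (toℕ (g y)) else 0) (allFin n))

IsDAntimagicLabeling : (n : ℕ) .{{_ : NonZero n}} → DistSet → (Fin n → Fin n) → Set
IsDAntimagicLabeling n D g =
  Injective _≡_ _≡_ g × Injective _≡_ _≡_ (weight n D g)

IsDAntimagic : (n : ℕ) .{{_ : NonZero n}} → DistSet → Set
IsDAntimagic n D = ∃ λ (g : Fin n → Fin n) → IsDAntimagicLabeling n D g

pairSet : (n : ℕ) .{{_ : NonZero n}} → ℕ → ℕ → DistSet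
pairSet n a k x = (x ≡ᵇ a) ∨ (x ≡ᵇ ((a + k) % n))

coPairSet : (n : ℕ) .{{_ : NonZero n}} → ℕ → ℕ → DistSet
coPairSet n a k x = not (pairSet n a k x)

-- Number the vertices 0,…,n−1 and give vertex u the label σ u + 1 for a permutation σ.
-- For D = {a, a + k} the weight of v is σ u + σ (u + k mod n) + 2 with u = v + a mod n,
-- and the weight for the complement of D is the total label sum minus that, so it
-- suffices to find σ whose step sums u ↦ σ u + σ (u + k mod n) are injective.
-- For odd n the identity works: the step sum is 2u + k or 2u + k − n, and these are
-- told apart by parity. For even n, σ is a shift of the identity away from a few
-- vertices near 0; the step sum is then affine of slope 2 on the regular vertices,
-- and the few exceptional values are distinct and avoid the regular ones by parity
-- or size. The cases n = 4 and n = 8 for k = 3 are decided by computation.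

module Submission where

open import Defs
open import Data.Bool using (true; false; _∨_; not; if_then_else_; T)
open import Data.Empty using (⊥; ⊥-elim)
open import Data.Fin as Fin using (Fin; toℕ; fromℕ<)
open import Data.Fin.Properties using (toℕ-injective; toℕ-fromℕ<; toℕ<n)
  renaming (_≟_ to _≟ᶠ_)
open import Data.List as List using (List; []; _∷_; tabulate)
open import Data.List.Properties using (map-tabulate; tabulate-cong)
open import Data.List.Membership.Propositional using (_∈_)
open import Data.List.Relation.Unary.Any using (here; there)
open import Data.List.Relation.Unary.All using (All; []; _∷_; lookup)
open import Data.List.Relation.Unary.AllPairs as AllPairs using (AllPairs; []; _∷_)
open import Data.List.Relation.Unary.Linked using (Linked; []; [-]; _∷_)
open import Data.List.Relation.Unary.Linked.Properties using (Linked⇒AllPairs)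
open import Data.Nat
open import Data.Nat.Properties
open import Data.Nat.DivMod
open import Data.Nat.ListAction using (sum)
open import Data.Nat.Tactic.RingSolver using (solve)
open import Algebra.Properties.CommutativeSemigroup +-commutativeSemigroup using (interchange)
open import Data.Product using (∃; _×_; _,_; proj₁; proj₂)
open import Data.Sum using (_⊎_; inj₁; inj₂)
open import Function using (_∘_; id; _on_; _⇔_; mk⇔)
open import Function.Definitions using (Injective)
open import Relation.Binary.PropositionalEquality
open import Relation.Nullary using (Dec; yes; no; map′; _×-dec_; _→-dec_)
open import Relation.Nullary.Decidable using (does; does-⇔; from-yes)

T-does⇒ : ∀ {A : Set} (a? : Dec A) → T (does a?) → A
T-does⇒ (yes a) _ = a

sum-tabulate-0 : ∀ n → sum (tabulate {n = n} (λ _ → 0)) ≡ 0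
sum-tabulate-0 zero = refl
sum-tabulate-0 (suc n) = sum-tabulate-0 n

sum-tabulate-+ : ∀ {n} (f g : Fin n → ℕ) →
  sum (tabulate (λ i → f i + g i)) ≡ sum (tabulate f) + sum (tabulate g)
sum-tabulate-+ {zero} f g = refl
sum-tabulate-+ {suc n} f g =
  trans (cong (f Fin.zero + g Fin.zero +_) (sum-tabulate-+ (f ∘ Fin.suc) (g ∘ Fin.suc)))
        (interchange (f Fin.zero) (g Fin.zero) _ _)

sum-tabulate-point : ∀ {n} (f : Fin n → ℕ) (j : Fin n) →
  sum (tabulate (λ i → if does (i ≟ᶠ j) then f i else 0)) ≡ f j
sum-tabulate-point {suc n} f Fin.zero =
  trans (cong (f Fin.zero +_) (sum-tabulate-0 n)) (+-identityʳ _)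
sum-tabulate-point {suc n} f (Fin.suc j) = sum-tabulate-point (f ∘ Fin.suc) j

if-∨ : ∀ x y {m : ℕ} → (T x → T y → ⊥) →
  (if x ∨ y then m else 0) ≡ (if x then m else 0) + (if y then m else 0)
if-∨ true  true  disjoint = ⊥-elim (disjoint _ _)
if-∨ true  false _ = sym (+-identityʳ _)
if-∨ false _     _ = refl

if-+-if-not : ∀ x {m : ℕ} → (if x then m else 0) + (if not x then m else 0) ≡ m
if-+-if-not true  = +-identityʳ _
if-+-if-not false = refl

[m%n+k]%n≡[m+k]%n : ∀ m k n .{{_ : NonZero n}} → (m % n + k) % n ≡ (m + k) % n
[m%n+k]%n≡[m+k]%n m k n = begin
  (m % n + k) % n         ≡⟨ %-distribˡ-+ (m % n) k n ⟩
  (m % n % n + k % n) % n ≡⟨ cong (λ r → (r + k % n) % n) (m%n%n≡m%n m n) ⟩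
  (m % n + k % n) % n     ≡⟨ %-distribˡ-+ m k n ⟨
  (m + k) % n             ∎
  where open ≡-Reasoning

[k+m%n]%n≡[k+m]%n : ∀ k m n .{{_ : NonZero n}} → (k + m % n) % n ≡ (k + m) % n
[k+m%n]%n≡[k+m]%n k m n = begin
  (k + m % n) % n ≡⟨ cong (_% n) (+-comm k (m % n)) ⟩
  (m % n + k) % n ≡⟨ [m%n+k]%n≡[m+k]%n m k n ⟩
  (m + k) % n     ≡⟨ cong (_% n) (+-comm m k) ⟩
  (k + m) % n     ∎
  where open ≡-Reasoning

%-cancelˡ : ∀ {n} .{{_ : NonZero n}} {v d e} → v < n → d < n → e < n →
  (v + d) % n ≡ (v + e) % n → d ≡ e
%-cancelˡ {n} {v = v} v<n d<n e<n eq =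
  trans (sym (subtract-v d<n)) (trans (cong (λ r → (r + (n ∸ v)) % n) eq) (subtract-v e<n))
  where
  open ≡-Reasoning
  subtract-v : ∀ {d} → d < n → ((v + d) % n + (n ∸ v)) % n ≡ d
  subtract-v {d} d<n = begin
    ((v + d) % n + (n ∸ v)) % n ≡⟨ [m%n+k]%n≡[m+k]%n (v + d) (n ∸ v) n ⟩
    (v + d + (n ∸ v)) % n       ≡⟨ cong (_% n) (+-assoc v d (n ∸ v)) ⟩
    (v + (d + (n ∸ v))) % n     ≡⟨ cong (λ r → (v + r) % n) (+-comm d (n ∸ v)) ⟩
    (v + ((n ∸ v) + d)) % n     ≡⟨ cong (_% n) (+-assoc v (n ∸ v) d) ⟨
    (v + (n ∸ v) + d) % n       ≡⟨ cong (λ r → (r + d) % n) (m+[n∸m]≡n (<⇒≤ v<n)) ⟩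
    (n + d) % n                 ≡⟨ cong (_% n) (+-comm n d) ⟩
    (d + n) % n                 ≡⟨ [m+n]%n≡m%n d n ⟩
    d % n                       ≡⟨ m<n⇒m%n≡m d<n ⟩
    d                           ∎

advance : ∀ {n} .{{_ : NonZero n}} → Fin n → ℕ → Fin n
advance {n} v d = (toℕ v + d) mod n

toℕ-advance : ∀ {n} .{{_ : NonZero n}} (v : Fin n) d →
  toℕ (advance v d) ≡ (toℕ v + d) % n
toℕ-advance {n} v d = toℕ-fromℕ< (m%n<n (toℕ v + d) n)

advance-dist : ∀ {n} .{{_ : NonZero n}} (v y : Fin n) → advance v (dist n v y) ≡ y
advance-dist {n} v y = toℕ-injective (begin
  toℕ (advance v (dist n v y))          ≡⟨ toℕ-advance v _ ⟩
  (toℕ v + (toℕ y + n ∸ toℕ v) % n) % n ≡⟨ [k+m%n]%n≡[k+m]%n (toℕ v) _ n ⟩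
  (toℕ v + (toℕ y + n ∸ toℕ v)) % n     ≡⟨ cong (_% n) (m+[n∸m]≡n v≤y+n) ⟩
  (toℕ y + n) % n                       ≡⟨ [m+n]%n≡m%n (toℕ y) n ⟩
  toℕ y % n                             ≡⟨ m<n⇒m%n≡m (toℕ<n y) ⟩
  toℕ y                                 ∎)
  where
  open ≡-Reasoning
  v≤y+n : toℕ v ≤ toℕ y + n
  v≤y+n = ≤-trans (<⇒≤ (toℕ<n v)) (m≤n+m n (toℕ y))

dist-advance : ∀ {n} .{{_ : NonZero n}} (v : Fin n) {d} → d < n → dist n v (advance v d) ≡ d
dist-advance {n} v {d} d<n = %-cancelˡ (toℕ<n v) (m%n<n _ n) d<n (begin
  (toℕ v + dist n v y) % n    ≡⟨ toℕ-advance v _ ⟨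
  toℕ (advance v (dist n v y)) ≡⟨ cong toℕ (advance-dist v y) ⟩
  toℕ y                        ≡⟨ toℕ-advance v d ⟩
  (toℕ v + d) % n              ∎)
  where
  open ≡-Reasoning
  y : Fin n
  y = advance v d

dist≡⇔≡advance : ∀ {n} .{{_ : NonZero n}} (v y : Fin n) {d} → d < n →
  dist n v y ≡ d ⇔ y ≡ advance v d
dist≡⇔≡advance v y d<n = mk⇔
  (λ dist≡d → trans (sym (advance-dist v y)) (cong (advance v) dist≡d))
  (λ y≡advance → trans (cong (dist _ v) y≡advance) (dist-advance v d<n))

label : ∀ {n} → (Fin n → Fin n) → Fin n → ℕ
label g y = suc (toℕ (g y))

weight-tabulate : ∀ n .{{_ : NonZero n}} D g v →
  weight n D g v ≡ sum (tabulate (λ y → if D (dist n v y) then label g y else 0))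
weight-tabulate n D g v =
  cong sum (map-tabulate id (λ y → if D (dist n v y) then label g y else 0))

weight-+-weight-not : ∀ n .{{_ : NonZero n}} D g v →
  weight n D g v + weight n (not ∘ D) g v ≡ sum (tabulate (label g))
weight-+-weight-not n D g v = begin
  weight n D g v + weight n (not ∘ D) g v
    ≡⟨ cong₂ _+_ (weight-tabulate n D g v) (weight-tabulate n (not ∘ D) g v) ⟩
  sum (tabulate (λ y → if D (dist n v y) then label g y else 0)) +
  sum (tabulate (λ y → if not (D (dist n v y)) then label g y else 0))
    ≡⟨ sum-tabulate-+ (λ y → if D (dist n v y) then label g y else 0)
                      (λ y → if not (D (dist n v y)) then label g y else 0) ⟨
  sum (tabulate (λ y → (if D (dist n v y) then label g y else 0) +
                       (if not (D (dist n v y)) then label g y else 0)))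
    ≡⟨ cong sum (tabulate-cong (λ y → if-+-if-not (D (dist n v y)))) ⟩
  sum (tabulate (label g)) ∎
  where open ≡-Reasoning

antimagic-complement : ∀ {n} .{{_ : NonZero n}} {D g} →
  IsDAntimagicLabeling n D g → IsDAntimagicLabeling n (not ∘ D) g
antimagic-complement {n} {D = D} {g} (g-injective , weight-injective) =
  g-injective , λ {v} {w} eq → weight-injective (+-cancelʳ-≡ _ _ _ (begin
    weight n D g v + weight n (not ∘ D) g v ≡⟨ weight-+-weight-not n D g v ⟩
    sum (tabulate (label g))                ≡⟨ weight-+-weight-not n D g w ⟨
    weight n D g w + weight n (not ∘ D) g w ≡⟨ cong (weight n D g w +_) eq ⟨
    weight n D g w + weight n (not ∘ D) g v ∎))
  where open ≡-Reasoning

weight-pair : ∀ {n} .{{_ : NonZero n}} (g : Fin n → Fin n) (v : Fin n) {a b} →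
  a < n → b < n → a ≢ b →
  weight n (λ x → (x ≡ᵇ a) ∨ (x ≡ᵇ b)) g v
    ≡ label g (advance v a) + label g (advance v b)
weight-pair {n} g v {a} {b} a<n b<n a≢b = begin
  weight n D g v
    ≡⟨ weight-tabulate n D g v ⟩
  sum (tabulate (λ y → if D (dist n v y) then label g y else 0))
    ≡⟨ cong sum (tabulate-cong split) ⟩
  sum (tabulate (λ y → point p y + point q y))
    ≡⟨ sum-tabulate-+ (point p) (point q) ⟩
  sum (tabulate (point p)) + sum (tabulate (point q))
    ≡⟨ cong₂ _+_ (sum-tabulate-point (label g) p) (sum-tabulate-point (label g) q) ⟩
  label g p + label g q ∎
  where
  open ≡-Reasoning
  D : DistSet
  D x = (x ≡ᵇ a) ∨ (x ≡ᵇ b)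
  p q : Fin n
  p = advance v a
  q = advance v b
  point : Fin n → Fin n → ℕ
  point j y = if does (y ≟ᶠ j) then label g y else 0
  ≡ᵇ-as-≟ᶠ : ∀ {d} → d < n → ∀ y →
    (dist n v y ≡ᵇ d) ≡ does (y ≟ᶠ advance v d)
  ≡ᵇ-as-≟ᶠ d<n y = does-⇔ (dist≡⇔≡advance v y d<n) (dist n v y ≟ _) (y ≟ᶠ _)
  p≢q : ∀ {y} → T (does (y ≟ᶠ p)) → T (does (y ≟ᶠ q)) → ⊥
  p≢q {y} y≡p y≡q = a≢b (begin
    a          ≡⟨ dist-advance v a<n ⟨
    dist n v p ≡⟨ cong (dist n v) (T-does⇒ (y ≟ᶠ p) y≡p) ⟨
    dist n v y ≡⟨ cong (dist n v) (T-does⇒ (y ≟ᶠ q) y≡q) ⟩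
    dist n v q ≡⟨ dist-advance v b<n ⟩
    b          ∎)
  split : ∀ y → (if D (dist n v y) then label g y else 0) ≡ point p y + point q y
  split y = trans
    (cong₂ (λ s t → if s ∨ t then label g y else 0) (≡ᵇ-as-≟ᶠ a<n y) (≡ᵇ-as-≟ᶠ b<n y))
    (if-∨ (does (y ≟ᶠ p)) (does (y ≟ᶠ q)) (p≢q {y}))

InjectiveOn : ℕ → (ℕ → ℕ) → Set
InjectiveOn n f = ∀ {u} → u < n → ∀ {w} → w < n → f u ≡ f w → u ≡ w

injectiveOn? : ∀ n f → Dec (InjectiveOn n f)
injectiveOn? n f = allUpTo? (λ u → allUpTo? (λ w → (f u ≟ f w) →-dec (u ≟ w)) n) n

stepSum : (n k : ℕ) .{{_ : NonZero n}} → (ℕ → ℕ) → ℕ → ℕ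
stepSum n k σ u = σ u + σ ((u + k) % n)

record IsStepSumPermutation (n k : ℕ) .{{_ : NonZero n}} (σ : ℕ → ℕ) : Set where
  field
    bounded           : ∀ {u} → u < n → σ u < n
    injective         : InjectiveOn n σ
    stepSum-injective : InjectiveOn n (stepSum n k σ)

isStepSumPermutation? : ∀ n k .{{_ : NonZero n}} σ → Dec (IsStepSumPermutation n k σ)
isStepSumPermutation? n k σ = map′ fromFields toFields
  (allUpTo? (λ u → σ u <? n) n ×-dec injectiveOn? n σ ×-dec injectiveOn? n (stepSum n k σ))
  where
  Fields : Set
  Fields = (∀ {u} → u < n → σ u < n) × InjectiveOn n σ × InjectiveOn n (stepSum n k σ)
  fromFields : Fields → IsStepSumPermutation n k σ
  fromFields (b , i , s) = record { bounded = b ; injective = i ; stepSum-injective = s }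
  toFields : IsStepSumPermutation n k σ → Fields
  toFields P = let open IsStepSumPermutation P in bounded , injective , stepSum-injective

module _ {n k σ} .{{_ : NonZero n}} (P : IsStepSumPermutation n k σ) where
  open IsStepSumPermutation P

  labelling : Fin n → Fin n
  labelling i = fromℕ< (bounded (toℕ<n i))

  label-labelling : ∀ i → label labelling i ≡ suc (σ (toℕ i))
  label-labelling i = cong suc (toℕ-fromℕ< (bounded (toℕ<n i)))

  labelling-injective : Injective _≡_ _≡_ labelling
  labelling-injective {i} {j} eq = toℕ-injective (injective (toℕ<n i) (toℕ<n j) (begin
    σ (toℕ i)             ≡⟨ toℕ-fromℕ< _ ⟨
    toℕ (labelling i)     ≡⟨ cong toℕ eq ⟩
    toℕ (labelling j)     ≡⟨ toℕ-fromℕ< _ ⟩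
    σ (toℕ j)             ∎))
    where open ≡-Reasoning

  module _ {a} (0<k : 0 < k) (k<n : k < n) (a<n : a < n) where

    a≢a+k : a ≢ (a + k) % n
    a≢a+k eq = <⇒≢ 0<k (%-cancelˡ a<n (≤-<-trans z≤n k<n) k<n (begin
      (a + 0) % n ≡⟨ cong (_% n) (+-identityʳ a) ⟩
      a % n       ≡⟨ m<n⇒m%n≡m a<n ⟩
      a           ≡⟨ eq ⟩
      (a + k) % n ∎))
      where open ≡-Reasoning

    weight-pairSet : ∀ v →
      weight n (pairSet n a k) labelling v ≡ 2 + stepSum n k σ ((toℕ v + a) % n)
    weight-pairSet v = begin
      weight n (pairSet n a k) labelling v
        ≡⟨ weight-pair labelling v a<n (m%n<n (a + k) n) a≢a+k ⟩
      label labelling (advance v a) + label labelling (advance v ((a + k) % n))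
        ≡⟨ cong₂ _+_ (label-labelling _) (label-labelling _) ⟩
      suc (σ (toℕ (advance v a))) + suc (σ (toℕ (advance v ((a + k) % n))))
        ≡⟨ cong₂ (λ r s → suc (σ r) + suc (σ s)) (toℕ-advance v a) second ⟩
      suc (σ u) + suc (σ ((u + k) % n))
        ≡⟨ cong suc (+-suc (σ u) _) ⟩
      2 + stepSum n k σ u ∎
      where
      open ≡-Reasoning
      u : ℕ
      u = (toℕ v + a) % n
      second : toℕ (advance v ((a + k) % n)) ≡ (u + k) % n
      second = begin
        toℕ (advance v ((a + k) % n)) ≡⟨ toℕ-advance v _ ⟩
        (toℕ v + (a + k) % n) % n     ≡⟨ [k+m%n]%n≡[k+m]%n (toℕ v) (a + k) n ⟩
        (toℕ v + (a + k)) % n         ≡⟨ cong (_% n) (+-assoc (toℕ v) a k) ⟨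
        (toℕ v + a + k) % n           ≡⟨ [m%n+k]%n≡[m+k]%n (toℕ v + a) k n ⟨
        (u + k) % n                   ∎

    pairSet-antimagic : IsDAntimagicLabeling n (pairSet n a k) labelling
    pairSet-antimagic = labelling-injective , weight-injective
      where
      weight-injective : Injective _≡_ _≡_ (weight n (pairSet n a k) labelling)
      weight-injective {v} {w} eq = toℕ-injective (%-cancelˡ a<n (toℕ<n v) (toℕ<n w) (begin
        (a + toℕ v) % n ≡⟨ cong (_% n) (+-comm a (toℕ v)) ⟩
        (toℕ v + a) % n ≡⟨ stepSum-injective (m%n<n _ n) (m%n<n _ n) stepSums≡ ⟩
        (toℕ w + a) % n ≡⟨ cong (_% n) (+-comm (toℕ w) a) ⟩
        (a + toℕ w) % n ∎))
        where
        open ≡-Reasoning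
        stepSums≡ : stepSum n k σ ((toℕ v + a) % n) ≡ stepSum n k σ ((toℕ w + a) % n)
        stepSums≡ = +-cancelˡ-≡ 2 _ _ (trans (sym (weight-pairSet v)) (trans eq (weight-pairSet w)))

  stepSum⇒antimagic : ∀ {a} → 0 < k → k < n → a < n →
    IsDAntimagic n (pairSet n a k) × IsDAntimagic n (coPairSet n a k)
  stepSum⇒antimagic 0<k k<n a<n =
    (labelling , pairSet-antimagic 0<k k<n a<n) ,
    (labelling , antimagic-complement {D = pairSet n _ k} (pairSet-antimagic 0<k k<n a<n))

data Step (n k u : ℕ) .{{_ : NonZero n}} : Set where
  inside : u + k < n → (u + k) % n ≡ u + k → Step n k u
  wraps  : ∀ j → j < k → u ≡ j + (n ∸ k) → (u + k) % n ≡ j → Step n k u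

step : ∀ {n k u} .{{_ : NonZero n}} → k ≤ n → u < n → Step n k u
step {n} {k} {u} k≤n u<n with u + k <? n
... | yes u+k<n = inside u+k<n (m<n⇒m%n≡m u+k<n)
... | no  u+k≮n = wraps j j<k u≡j+[n∸k] [u+k]%n≡j
  where
  j : ℕ
  j = u + k ∸ n
  u+k≡j+n : u + k ≡ j + n
  u+k≡j+n = sym (m∸n+n≡m (≮⇒≥ u+k≮n))
  j<k : j < k
  j<k = +-cancelʳ-< n j k (begin-strict
    j + n ≡⟨ u+k≡j+n ⟨
    u + k <⟨ +-monoˡ-< k u<n ⟩
    n + k ≡⟨ +-comm n k ⟩
    k + n ∎)
    where open ≤-Reasoning
  u≡j+[n∸k] : u ≡ j + (n ∸ k)
  u≡j+[n∸k] = +-cancelʳ-≡ k u (j + (n ∸ k)) (begin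
    u + k           ≡⟨ u+k≡j+n ⟩
    j + n           ≡⟨ cong (j +_) (m∸n+n≡m k≤n) ⟨
    j + (n ∸ k + k) ≡⟨ +-assoc j (n ∸ k) k ⟨
    j + (n ∸ k) + k ∎)
    where open ≡-Reasoning
  [u+k]%n≡j : (u + k) % n ≡ j
  [u+k]%n≡j = begin
    (u + k) % n ≡⟨ cong (_% n) u+k≡j+n ⟩
    (j + n) % n ≡⟨ [m+n]%n≡m%n j n ⟩
    j % n       ≡⟨ m<n⇒m%n≡m (<-≤-trans j<k k≤n) ⟩
    j           ∎
    where open ≡-Reasoning

m+n<n+o⇒m<o : ∀ {x k m} → x + k < k + m → x < m
m+n<n+o⇒m<o {x} {k} {m} l = +-cancelˡ-< k x m (subst (_< k + m) (+-comm x k) l)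

+-*2-cancel : ∀ c {x y} → c + x * 2 ≡ c + y * 2 → x ≡ y
+-*2-cancel c {x} {y} eq = *-cancelʳ-≡ x y 2 (+-cancelˡ-≡ c _ _ eq)

≢-by-parity : ∀ m n x y → m % 2 ≢ n % 2 → m + x * 2 ≢ n + y * 2
≢-by-parity m n x y parities≢ eq = parities≢ (begin
  m % 2           ≡⟨ [m+kn]%n≡m%n m x 2 ⟨
  (m + x * 2) % 2 ≡⟨ cong (_% 2) eq ⟩
  (n + y * 2) % 2 ≡⟨ [m+kn]%n≡m%n n y 2 ⟩
  n % 2           ∎)
  where open ≡-Reasoning

proj₁-determined : ∀ {es : List (ℕ × ℕ)} {u w c} →
  AllPairs (λ e e′ → proj₂ e ≢ proj₂ e′) es →
  (u , c) ∈ es → (w , c) ∈ es → u ≡ w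
proj₁-determined _                (here refl) (here refl) = refl
proj₁-determined (distinct ∷ _)  (here refl) (there w∈) = ⊥-elim (lookup distinct w∈ refl)
proj₁-determined (distinct ∷ _)  (there u∈) (here refl) = ⊥-elim (lookup distinct u∈ refl)
proj₁-determined (_ ∷ distinct)  (there u∈) (there w∈) =
  proj₁-determined distinct u∈ w∈

data Profile (h : ℕ → ℕ) (s B : ℕ) (r : ℕ → ℕ) (es : List (ℕ × ℕ)) (u : ℕ) :
  Set where
  regular     : ∀ x → x < B → u ≡ s + x → h u ≡ r x → Profile h s B r es u
  exceptional : ∀ c → (u , c) ∈ es → h u ≡ c → Profile h s B r es u

profile⇒injectiveOn : ∀ {n h s B r es} →
  (∀ {x y} → r x ≡ r y → x ≡ y) →
  Linked (_<_ on proj₂) es →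
  All (λ e → ∀ {x} → x < B → r x ≢ proj₂ e) es →
  (∀ {u} → u < n → Profile h s B r es u) →
  InjectiveOn n h
profile⇒injectiveOn {s = s} r-injective sorted apart profile {u} u<n {w} w<n hu≡hw
  with profile u<n | profile w<n
... | regular x _ refl hu≡rx | regular y _ refl hw≡ry =
  cong (s +_) (r-injective (trans (sym hu≡rx) (trans hu≡hw hw≡ry)))
... | exceptional _ u∈ refl | exceptional _ w∈ refl =
  proj₁-determined (AllPairs.map <⇒≢ (Linked⇒AllPairs <-trans sorted))
    u∈ (subst (λ c → (w , c) ∈ _) (sym hu≡hw) w∈)
... | regular x x<B _ hu≡rx | exceptional _ w∈ refl =
  ⊥-elim (lookup apart w∈ x<B (trans (sym hu≡rx) hu≡hw))
... | exceptional _ u∈ refl | regular y y<B _ hw≡ry =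
  ⊥-elim (lookup apart u∈ y<B (trans (sym hw≡ry) (sym hu≡hw)))

id-isStepSumPermutation : ∀ t {k} → k ≤ 1 + t * 2 → IsStepSumPermutation (1 + t * 2) k id
id-isStepSumPermutation t {k} k≤n = record
  { bounded = id ; injective = λ _ _ → id ; stepSum-injective = stepSum-injective }
  where
  n : ℕ
  n = 1 + t * 2

  unwrapped : ℕ → ℕ
  unwrapped u = k + u * 2

  unwrapped-≡ : ∀ u → u + (u + k) ≡ k + u * 2
  unwrapped-≡ u = solve (u List.∷ k List.∷ List.[])

  shape : ∀ {u} → u < n →
    stepSum n k id u ≡ unwrapped u ⊎ stepSum n k id u + n ≡ unwrapped u
  shape {u} u<n with step k≤n u<n
  ... | inside _ e = inj₁ (trans (cong (u +_) e) (unwrapped-≡ u))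
  ... | wraps j _ u≡ e = inj₂ (begin
    u + (u + k) % n + n   ≡⟨ cong (λ r → u + r + n) e ⟩
    u + j + n             ≡⟨ +-assoc u j n ⟩
    u + (j + n)           ≡⟨ cong (λ r → u + (j + r)) (m∸n+n≡m k≤n) ⟨
    u + (j + (n ∸ k + k)) ≡⟨ cong (u +_) (+-assoc j (n ∸ k) k) ⟨
    u + (j + (n ∸ k) + k) ≡⟨ cong (λ r → u + (r + k)) u≡ ⟨
    u + (u + k)           ≡⟨ unwrapped-≡ u ⟩
    unwrapped u           ∎)
    where open ≡-Reasoning

  unwrapped+n≢unwrapped : ∀ u w → unwrapped u + n ≢ unwrapped w
  unwrapped+n≢unwrapped u w eq = ≢-by-parity 1 0 (u + t) w (λ ()) (+-cancelˡ-≡ k _ _ (begin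
    k + (1 + (u + t) * 2)   ≡⟨ solve (u List.∷ t List.∷ k List.∷ List.[]) ⟩
    k + u * 2 + (1 + t * 2) ≡⟨ eq ⟩
    unwrapped w             ∎))
    where open ≡-Reasoning

  stepSum-injective : InjectiveOn n (stepSum n k id)
  stepSum-injective {u} u<n {w} w<n eq with shape u<n | shape w<n
  ... | inj₁ hu | inj₁ hw = +-*2-cancel k (trans (sym hu) (trans eq hw))
  ... | inj₂ hu | inj₂ hw = +-*2-cancel k (trans (sym hu) (trans (cong (_+ n) eq) hw))
  ... | inj₁ hu | inj₂ hw =
    ⊥-elim (unwrapped+n≢unwrapped u w (trans (cong (_+ n) (trans (sym hu) eq)) hw))
  ... | inj₂ hu | inj₁ hw =
    ⊥-elim (unwrapped+n≢unwrapped w u (trans (cong (_+ n) (trans (sym hw) (sym eq))) hu))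

transpose₀₁ : ℕ → ℕ
transpose₀₁ 0 = 1
transpose₀₁ 1 = 0
transpose₀₁ u = u

transpose₀₁-involutive : ∀ u → transpose₀₁ (transpose₀₁ u) ≡ u
transpose₀₁-involutive 0 = refl
transpose₀₁-involutive 1 = refl
transpose₀₁-involutive (suc (suc u)) = refl

module EvenStep₁ (t : ℕ) where
  open ≡-Reasoning
  private
    n : ℕ
    n = 4 + t * 2
    σ : ℕ → ℕ
    σ = transpose₀₁

  exceptions : List (ℕ × ℕ)
  exceptions = (0 , 1) ∷ (1 , 2) ∷ (3 + t * 2 , 4 + t * 2) ∷ []

  StepSumProfile : ℕ → Set
  StepSumProfile = Profile (stepSum n 1 σ) 2 (1 + t * 2) (λ x → 5 + x * 2) exceptions

  inside-profile : ∀ {u} → u + 1 < n → (u + 1) % n ≡ u + 1 → StepSumProfile u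
  inside-profile {0} _ _ = exceptional _ (here refl) refl
  inside-profile {1} _ _ = exceptional _ (there (here refl)) refl
  inside-profile {suc (suc x)} (s≤s (s≤s l)) e =
    regular x (m+n<n+o⇒m<o l) refl (begin
      stepSum n 1 σ (2 + x)   ≡⟨ cong (λ j → σ (2 + x) + σ j) e ⟩
      (2 + x) + (2 + (x + 1)) ≡⟨ solve (x List.∷ List.[]) ⟩
      5 + x * 2               ∎)

  stepSum-profile : ∀ {u} → u < n → StepSumProfile u
  stepSum-profile u<n with step (s≤s z≤n) u<n
  ... | inside u+1<n e = inside-profile u+1<n e
  ... | wraps 0 _ refl e =
    exceptional _ (there (there (here refl))) (begin
      stepSum n 1 σ (3 + t * 2) ≡⟨ cong (λ j → σ (3 + t * 2) + σ j) e ⟩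
      (3 + t * 2) + 1           ≡⟨ +-comm (3 + t * 2) 1 ⟩
      4 + t * 2                 ∎)
  ... | wraps (suc _) (s≤s ()) _ _

  isStepSumPermutation : IsStepSumPermutation n 1 σ
  isStepSumPermutation = record
    { bounded = bounded
    ; injective = λ _ _ eq →
        trans (sym (transpose₀₁-involutive _)) (trans (cong σ eq) (transpose₀₁-involutive _))
    ; stepSum-injective = profile⇒injectiveOn (+-*2-cancel 5)
        (s<s z<s ∷ s<s (s<s z<s) ∷ [-])
        ((λ _ ()) ∷ (λ _ ()) ∷ (λ {x} _ → ≢-by-parity 5 4 x t (λ ())) ∷ [])
        stepSum-profile
    }
    where
    bounded : ∀ {u} → u < n → σ u < n
    bounded {0} _ = s<s z<s
    bounded {1} _ = z<s
    bounded {suc (suc _)} l = l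

module EvenStep₂ (t : ℕ) where
  open ≡-Reasoning
  private
    n : ℕ
    n = 6 + t * 2

  σ : ℕ → ℕ
  σ 0 = 0
  σ 1 = 5 + t * 2
  σ (suc (suc x)) = suc x

  σ-profile : ∀ {u} → u < n →
    Profile σ 2 (4 + t * 2) suc ((0 , 0) ∷ (1 , 5 + t * 2) ∷ []) u
  σ-profile {0} _ = exceptional _ (here refl) refl
  σ-profile {1} _ = exceptional _ (there (here refl)) refl
  σ-profile {suc (suc x)} (s≤s (s≤s l)) = regular x l refl refl

  exceptions : List (ℕ × ℕ)
  exceptions =
    (0 , 1) ∷ (4 + t * 2 , 3 + t * 2) ∷ (1 , 7 + t * 2) ∷ (5 + t * 2 , 9 + t * 2 * 2) ∷ []

  StepSumProfile : ℕ → Set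
  StepSumProfile = Profile (stepSum n 2 σ) 2 (2 + t * 2) (λ x → 4 + x * 2) exceptions

  inside-profile : ∀ {u} → u + 2 < n → (u + 2) % n ≡ u + 2 → StepSumProfile u
  inside-profile {0} _ _ = exceptional _ (here refl) refl
  inside-profile {1} _ _ = exceptional _ (there (there (here refl))) (+-comm (5 + t * 2) 2)
  inside-profile {suc (suc x)} (s≤s (s≤s l)) e =
    regular x (m+n<n+o⇒m<o l) refl (begin
      stepSum n 2 σ (2 + x)   ≡⟨ cong (λ j → σ (2 + x) + σ j) e ⟩
      (1 + x) + (1 + (x + 2)) ≡⟨ solve (x List.∷ List.[]) ⟩
      4 + x * 2               ∎)

  stepSum-profile : ∀ {u} → u < n → StepSumProfile u
  stepSum-profile u<n with step (s≤s (s≤s z≤n)) u<n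
  ... | inside u+2<n e = inside-profile u+2<n e
  ... | wraps 0 _ refl e = exceptional _ (there (here refl)) (begin
    stepSum n 2 σ (4 + t * 2) ≡⟨ cong (λ j → σ (4 + t * 2) + σ j) e ⟩
    (3 + t * 2) + 0           ≡⟨ +-identityʳ _ ⟩
    3 + t * 2                 ∎)
  ... | wraps 1 _ refl e = exceptional _ (there (there (there (here refl)))) (begin
    stepSum n 2 σ (5 + t * 2)   ≡⟨ cong (λ j → σ (5 + t * 2) + σ j) e ⟩
    (4 + t * 2) + (5 + t * 2)   ≡⟨ solve (t List.∷ List.[]) ⟩
    9 + t * 2 * 2               ∎)
  ... | wraps (suc (suc _)) (s≤s (s≤s ())) _ _

  isStepSumPermutation : IsStepSumPermutation n 2 σ
  isStepSumPermutation = record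
    { bounded = bounded
    ; injective = profile⇒injectiveOn suc-injective
        (z<s ∷ [-])
        ((λ _ ()) ∷ (λ x< → <⇒≢ (s<s x<)) ∷ [])
        σ-profile
    ; stepSum-injective = profile⇒injectiveOn (+-*2-cancel 4)
        (s<s z<s ∷ m≤n+m (4 + t * 2) 3 ∷ +-mono-≤ (n≤1+n 8) (m≤m*n (t * 2) 2) ∷ [-])
        ((λ _ ()) ∷
         (λ {x} _ → ≢-by-parity 4 3 x t (λ ())) ∷
         (λ {x} _ → ≢-by-parity 4 7 x t (λ ())) ∷
         (λ {x} _ → ≢-by-parity 4 9 x (t * 2) (λ ())) ∷ [])
        stepSum-profile
    }
    where
    bounded : ∀ {u} → u < n → σ u < n
    bounded {0} _ = z<s
    bounded {1} _ = n<1+n _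
    bounded {suc (suc x)} l = <-trans (n<1+n (suc x)) l

module EvenStep₃ (t : ℕ) where
  open ≡-Reasoning
  private
    n : ℕ
    n = 10 + t * 2

  σ : ℕ → ℕ
  σ 0 = 9 + t * 2
  σ 1 = 0
  σ 2 = 1
  σ 3 = 8 + t * 2
  σ (suc (suc (suc (suc x)))) = suc (suc x)

  σ-profile : ∀ {u} → u < n →
    Profile σ 4 (6 + t * 2) (2 +_)
      ((1 , 0) ∷ (2 , 1) ∷ (3 , 8 + t * 2) ∷ (0 , 9 + t * 2) ∷ []) u
  σ-profile {0} _ = exceptional _ (there (there (there (here refl)))) refl
  σ-profile {1} _ = exceptional _ (here refl) refl
  σ-profile {2} _ = exceptional _ (there (here refl)) refl
  σ-profile {3} _ = exceptional _ (there (there (here refl))) refl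
  σ-profile {suc (suc (suc (suc x)))} (s≤s (s≤s (s≤s (s≤s l)))) = regular x l refl refl

  exceptions : List (ℕ × ℕ)
  exceptions =
    (1 , 2) ∷ (2 , 4) ∷ (8 + t * 2 , 6 + t * 2) ∷ (9 + t * 2 , 8 + t * 2) ∷
    (3 , 12 + t * 2) ∷ (7 + t * 2 , 14 + t * 2 * 2) ∷ (0 , 17 + t * 2 * 2) ∷ []

  StepSumProfile : ℕ → Set
  StepSumProfile = Profile (stepSum n 3 σ) 4 (3 + t * 2) (λ x → 7 + x * 2) exceptions

  inside-profile : ∀ {u} → u + 3 < n → (u + 3) % n ≡ u + 3 → StepSumProfile u
  inside-profile {0} _ _ = exceptional _ (there (there (there (there (there (there (here refl)))))))
    (begin
      (9 + t * 2) + (8 + t * 2) ≡⟨ solve (t List.∷ List.[]) ⟩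
      17 + t * 2 * 2            ∎)
  inside-profile {1} _ _ = exceptional _ (here refl) refl
  inside-profile {2} _ _ = exceptional _ (there (here refl)) refl
  inside-profile {3} _ _ =
    exceptional _ (there (there (there (there (here refl))))) (+-comm (8 + t * 2) 4)
  inside-profile {suc (suc (suc (suc x)))} (s≤s (s≤s (s≤s (s≤s l)))) e =
    regular x (m+n<n+o⇒m<o l) refl (begin
      stepSum n 3 σ (4 + x)   ≡⟨ cong (λ j → σ (4 + x) + σ j) e ⟩
      (2 + x) + (2 + (x + 3)) ≡⟨ solve (x List.∷ List.[]) ⟩
      7 + x * 2               ∎)

  stepSum-profile : ∀ {u} → u < n → StepSumProfile u
  stepSum-profile u<n with step (s≤s (s≤s (s≤s z≤n))) u<n
  ... | inside u+3<n e = inside-profile u+3<n e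
  ... | wraps 0 _ refl e = exceptional _ (there (there (there (there (there (here refl))))))
    (begin
      stepSum n 3 σ (7 + t * 2) ≡⟨ cong (λ j → σ (7 + t * 2) + σ j) e ⟩
      (5 + t * 2) + (9 + t * 2) ≡⟨ solve (t List.∷ List.[]) ⟩
      14 + t * 2 * 2            ∎)
  ... | wraps 1 _ refl e = exceptional _ (there (there (here refl))) (begin
    stepSum n 3 σ (8 + t * 2) ≡⟨ cong (λ j → σ (8 + t * 2) + σ j) e ⟩
    (6 + t * 2) + 0           ≡⟨ +-identityʳ _ ⟩
    6 + t * 2                 ∎)
  ... | wraps 2 _ refl e = exceptional _ (there (there (there (here refl)))) (begin
    stepSum n 3 σ (9 + t * 2) ≡⟨ cong (λ j → σ (9 + t * 2) + σ j) e ⟩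
    (7 + t * 2) + 1           ≡⟨ +-comm (7 + t * 2) 1 ⟩
    8 + t * 2                 ∎)
  ... | wraps (suc (suc (suc _))) (s≤s (s≤s (s≤s ()))) _ _

  isStepSumPermutation : IsStepSumPermutation n 3 σ
  isStepSumPermutation = record
    { bounded = bounded
    ; injective = profile⇒injectiveOn (+-cancelˡ-≡ 2 _ _)
        (z<s ∷ s<s z<s ∷ n<1+n _ ∷ [-])
        ((λ _ ()) ∷ (λ _ ()) ∷
         (λ x< → <⇒≢ (s<s (s<s x<))) ∷ (λ x< → <⇒≢ (m<n⇒m<1+n (s<s (s<s x<)))) ∷ [])
        σ-profile
    ; stepSum-injective = profile⇒injectiveOn (+-*2-cancel 7)
        (s<s (s<s z<s) ∷ s<s (s<s (s<s (s<s z<s))) ∷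
         m≤n+m (7 + t * 2) 1 ∷ m≤n+m (9 + t * 2) 3 ∷
         +-mono-≤ (n≤1+n 13) (m≤m*n (t * 2) 2) ∷ m≤n+m (15 + t * 2 * 2) 2 ∷ [-])
        ((λ _ ()) ∷ (λ _ ()) ∷
         (λ {x} _ → ≢-by-parity 7 6 x t (λ ())) ∷
         (λ {x} _ → ≢-by-parity 7 8 x t (λ ())) ∷
         (λ {x} _ → ≢-by-parity 7 12 x t (λ ())) ∷
         (λ {x} _ → ≢-by-parity 7 14 x (t * 2) (λ ())) ∷
         (λ x< → <⇒≢ (<-≤-trans (+-monoʳ-< 7 (*-monoˡ-< 2 x<)) (m≤n+m _ 4))) ∷ [])
        stepSum-profile
    }
    where
    bounded : ∀ {u} → u < n → σ u < n
    bounded {0} _ = n<1+n _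
    bounded {1} _ = z<s
    bounded {2} _ = s<s z<s
    bounded {3} _ = m<n⇒m<1+n (n<1+n _)
    bounded {suc (suc (suc (suc x)))} l = ≤-<-trans (m≤n+m (2 + x) 2) l

cycle₃₄₅ : ℕ → ℕ
cycle₃₄₅ 3 = 4
cycle₃₄₅ 4 = 5
cycle₃₄₅ 5 = 3
cycle₃₄₅ u = u

even⊎odd : ∀ n → (∃ λ t → n ≡ t * 2) ⊎ (∃ λ t → n ≡ 1 + t * 2)
even⊎odd zero = inj₁ (0 , refl)
even⊎odd (suc n) with even⊎odd n
... | inj₁ (t , refl) = inj₂ (t , refl)
... | inj₂ (t , refl) = inj₁ (suc t , refl)

stepSumPermutation₁ : ∀ n .{{_ : NonZero n}} → 3 ≤ n → ∃ (IsStepSumPermutation n 1)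
stepSumPermutation₁ n 3≤n with even⊎odd n
... | inj₂ (t , refl) = id , id-isStepSumPermutation t (s≤s z≤n)
... | inj₁ (suc (suc t) , refl) = transpose₀₁ , EvenStep₁.isStepSumPermutation t
stepSumPermutation₁ _ () | inj₁ (0 , refl)
stepSumPermutation₁ _ (s≤s (s≤s ())) | inj₁ (1 , refl)

stepSumPermutation₂ : ∀ n .{{_ : NonZero n}} → 3 ≤ n → n ≢ 4 →
  ∃ (IsStepSumPermutation n 2)
stepSumPermutation₂ n 3≤n n≢4 with even⊎odd n
... | inj₂ (t , refl) = id , id-isStepSumPermutation t (<⇒≤ 3≤n)
... | inj₁ (suc (suc (suc t)) , refl) = EvenStep₂.σ t , EvenStep₂.isStepSumPermutation t
... | inj₁ (2 , refl) = ⊥-elim (n≢4 refl)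
stepSumPermutation₂ _ () _ | inj₁ (0 , refl)
stepSumPermutation₂ _ (s≤s (s≤s ())) _ | inj₁ (1 , refl)

stepSumPermutation₃ : ∀ n .{{_ : NonZero n}} → 4 ≤ n → n ≢ 6 →
  ∃ (IsStepSumPermutation n 3)
stepSumPermutation₃ n 4≤n n≢6 with even⊎odd n
... | inj₂ (t , refl) = id , id-isStepSumPermutation t (<⇒≤ 4≤n)
... | inj₁ (suc (suc (suc (suc (suc t)))) , refl) =
  EvenStep₃.σ t , EvenStep₃.isStepSumPermutation t
... | inj₁ (2 , refl) = transpose₀₁ , from-yes (isStepSumPermutation? 4 3 transpose₀₁)
... | inj₁ (3 , refl) = ⊥-elim (n≢6 refl)
... | inj₁ (4 , refl) = cycle₃₄₅ , from-yes (isStepSumPermutation? 8 3 cycle₃₄₅)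
stepSumPermutation₃ _ () _ | inj₁ (0 , refl)
stepSumPermutation₃ _ (s≤s (s≤s ())) _ | inj₁ (1 , refl)

mainTheorem19 : (n : ℕ) .{{_ : NonZero n}} → 3 ≤ n → (a : ℕ) → a < n →
    IsDAntimagic n (pairSet n a 1)
    × (n ≢ 4 → IsDAntimagic n (pairSet n a 2))
    × (4 ≤ n → n ≢ 6 → IsDAntimagic n (pairSet n a 3))
    × IsDAntimagic n (coPairSet n a 1)
    × (n ≢ 4 → IsDAntimagic n (coPairSet n a 2))
    × (4 ≤ n → n ≢ 6 → IsDAntimagic n (coPairSet n a 3))
mainTheorem19 n 3≤n a a<n =
  proj₁ antimagic₁ , proj₁ ∘ antimagic₂ , (λ 4≤n → proj₁ ∘ antimagic₃ 4≤n) ,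
  proj₂ antimagic₁ , proj₂ ∘ antimagic₂ , (λ 4≤n → proj₂ ∘ antimagic₃ 4≤n)
  where
  PairAndCoPairAntimagic : ℕ → Set
  PairAndCoPairAntimagic k = IsDAntimagic n (pairSet n a k) × IsDAntimagic n (coPairSet n a k)

  antimagic : ∀ {k} → 0 < k → k < n → ∃ (IsStepSumPermutation n k) → PairAndCoPairAntimagic k
  antimagic 0<k k<n (_ , P) = stepSum⇒antimagic P 0<k k<n a<n

  antimagic₁ : PairAndCoPairAntimagic 1
  antimagic₁ = antimagic z<s (<-≤-trans (s<s z<s) 3≤n) (stepSumPermutation₁ n 3≤n)

  antimagic₂ : n ≢ 4 → PairAndCoPairAntimagic 2
  antimagic₂ n≢4 = antimagic z<s 3≤n (stepSumPermutation₂ n 3≤n n≢4)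

  antimagic₃ : 4 ≤ n → n ≢ 6 → PairAndCoPairAntimagic 3
  antimagic₃ 4≤n n≢6 = antimagic z<s 4≤n (stepSumPermutation₃ n 4≤n n≢6)
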